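{- Let $n = 2^m$ with $m \geq 2$, let $G = \{A \subseteq \{1,\dots,n-1\} : |A| \text{ even}\}$ under symmetric difference $\Delta$, and let $H$ be the subgroup of $G$ generated by $\{\{j, 2^{i-1}+j\} : j = 1, \dots, 2^{i-1}-1,\ i = 2, \dots, m\}$. Then: (1) no element of $H$ contains $2^m$, and no element of $H$ contains $2^{m-1}$; (2) if $A \in H$ contains $2^k$, then for some positive integer $t$ and some integers $k_1', \dots, k_t'$ each greater than $k$, the set $A$ contains $2^k + \sum_{i=1}^t 2^{k_i'}$; (3) $\{1, 2k+1\} \in H$ for every $1 \leq k \leq n/2 - 1$.
   Context: $\Delta$ denotes symmetric difference of sets. -}

module Defs where

open import Data.Nat using (ℕ; _+_; _*_; _∸_; _^_; _≤_; _≡ᵇ_)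
open import Data.Bool using (Bool; _∨_; _xor_)
open import Data.Fin using (Fin; toℕ)
open import Data.Fin.Subset using (Subset; _∈_; ⊥)
open import Data.Vec using (zipWith; tabulate)
open import Data.Product using (Σ; _×_; ∃)
open import Relation.Binary.PropositionalEquality using (_≡_)

-- Subsets of {0,…,n-1} are 'Subset n' (bit vectors indexed by Fin n).
-- Symmetric difference.
_Δ_ : ∀ {n} → Subset n → Subset n → Subset n
A Δ B = zipWith _xor_ A B

-- Membership of an arbitrary natural number x in a subset of {0,…,n-1}
-- (false whenever x ≥ n).
_∋ℕ_ : ∀ {n} → Subset n → ℕ → Set
A ∋ℕ x = Σ (Fin _) λ i → toℕ i ≡ x × i ∈ A

-- The two-element (or one-element if a ≡ b) set {a, b} inside {0,…,n-1}.
pair : (n a b : ℕ) → Subset n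
pair n a b = tabulate λ x → (toℕ x ≡ᵇ a) ∨ (toℕ x ≡ᵇ b)

IsGen : (m : ℕ) → Subset (2 ^ m) → Set
IsGen m A = ∃ λ i → ∃ λ j →
  2 ≤ i × i ≤ m × 1 ≤ j × j ≤ 2 ^ (i ∸ 1) ∸ 1 ×
  A ≡ pair (2 ^ m) j (2 ^ (i ∸ 1) + j)

-- H = subgroup (under Δ) generated by the generators: the smallest set
-- containing the generators and the identity ∅, closed under Δ
-- (every element is its own inverse).
data InH (m : ℕ) : Subset (2 ^ m) → Set where
  gen  : ∀ {A} → IsGen m A → InH m A
  zero : InH m ⊥
  _Δ-cl_ : ∀ {A B} → InH m A → InH m B → InH m (A Δ B)

-- Sort the numbers by 2-adic valuation: y has valuation k iff y ≡ 2^k (mod 2^(k+1)).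
-- Both elements of a generator {j, 2^e + j} (1 ≤ j < 2^e) have the same valuation, so
-- every A ∈ H meets each valuation class in an even number of points. Thus if 2^k ∈ A,
-- then A contains another number of valuation k, i.e. some 2^k + c·2^(k+1) with c ≥ 1;
-- for k = m − 1 this is at least 2^m, which is out of range. Conversely
-- {1, 2^e + j} = {1, j} Δ {j, 2^e + j}, which yields {1, 2k + 1} by induction on the
-- bit length of 2k + 1.

module Submission where

open import Defs
open import Data.Bool using (Bool; true; false; not; _∧_; _∨_; _xor_)
open import Algebra.Bundles using (CommutativeRing)
open import Data.Bool.Properties
  using (xor-∧-commutativeRing; ∧-distribˡ-xor; ∧-zeroʳ; ∧-identityʳ; xor-assoc; xor-same; xor-identityʳ; xor-is-ok)
open import Data.Empty using (⊥-elim)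
open import Data.Fin using (Fin; zero; suc; toℕ)
open import Data.Fin.Properties using (toℕ<n; toℕ-injective)
open import Data.Fin.Subset using (Subset; ⊥)
open import Data.List using (List; []; map; replicate)
open import Data.List.Relation.Unary.All using (All)
open import Data.List.Relation.Unary.All.Properties using (replicate⁺)
open import Data.List.Properties using (map-replicate)
open import Data.Nat using (ℕ; zero; suc; _+_; _*_; _∸_; _^_; _≤_; _<_; _≡ᵇ_; NonZero; z≤n; s≤s; _≤?_; _<?_; _≟_)
open import Data.Nat.DivMod using (_/_; _%_; m≡m%n+[m/n]*n; m<n⇒m%n≡m; %-remove-+ˡ; m*n/n≡m)
open import Data.Nat.Divisibility using (_∣_; 1∣_; *-monoʳ-∣)
open import Data.Nat.ListAction using (sum)
open import Data.Nat.Properties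
open import Data.Product using (_×_; ∃; _,_) renaming (map to Σ-map)
open import Data.Vec using ([]; _∷_; lookup; zipWith; tabulate)
open import Data.Vec.Properties using (tabulate-cong; lookup-zipWith; lookup∘tabulate; []=⇒lookup; lookup⇒[]=)
open import Function using (_∘_; id)
open import Algebra.Properties.CommutativeSemigroup (CommutativeRing.+-commutativeSemigroup xor-∧-commutativeRing) using (interchange)
open import Relation.Binary.PropositionalEquality
open import Relation.Nullary using (¬_; Dec; yes; no; does; contradiction)
open import Relation.Nullary.Decidable using (dec-true; dec-false)

xor-cancel-middle : ∀ p q r → (p xor q) xor (q xor r) ≡ p xor r
xor-cancel-middle p q r = begin
  (p xor q) xor (q xor r) ≡⟨ xor-assoc p q (q xor r) ⟩
  p xor (q xor (q xor r)) ≡⟨ cong (p xor_) (sym (xor-assoc q q r)) ⟩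
  p xor ((q xor q) xor r) ≡⟨ cong (λ b → p xor (b xor r)) (xor-same q) ⟩
  p xor r                 ∎
  where open ≡-Reasoning

∨≡xor : ∀ p q → p ∧ q ≡ false → p ∨ q ≡ p xor q
∨≡xor p q p∧q≡false = begin
  p ∨ q                   ≡⟨ sym (∧-identityʳ (p ∨ q)) ⟩
  (p ∨ q) ∧ not false     ≡⟨ cong (λ b → (p ∨ q) ∧ not b) (sym p∧q≡false) ⟩
  (p ∨ q) ∧ not (p ∧ q)   ≡⟨ sym (xor-is-ok p q) ⟩
  p xor q                 ∎
  where open ≡-Reasoning

Δ-cancel-middle : ∀ {n} (A B C : Subset n) → (A Δ B) Δ (B Δ C) ≡ A Δ C
Δ-cancel-middle [] [] [] = refl
Δ-cancel-middle (a ∷ A) (b ∷ B) (c ∷ C) = cong₂ _∷_ (xor-cancel-middle a b c) (Δ-cancel-middle A B C)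

zipWith-tabulate : ∀ {a b c} {A : Set a} {B : Set b} {C : Set c} {n} (f : A → B → C) (g : Fin n → A) (h : Fin n → B) →
  zipWith f (tabulate g) (tabulate h) ≡ tabulate (λ i → f (g i) (h i))
zipWith-tabulate {n = zero} f g h = refl
zipWith-tabulate {n = suc n} f g h = cong (_ ∷_) (zipWith-tabulate f (g ∘ suc) (h ∘ suc))

singleton : (n a : ℕ) → Subset n
singleton n a = tabulate λ x → toℕ x ≡ᵇ a

≡ᵇ-∧-≡ᵇ : ∀ {a b} → a ≢ b → ∀ x → (x ≡ᵇ a) ∧ (x ≡ᵇ b) ≡ false
≡ᵇ-∧-≡ᵇ {a} {b} a≢b x with x ≡ᵇ a | ≡ᵇ⇒≡ x a | x ≡ᵇ b | ≡ᵇ⇒≡ x b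
... | true  | x≡a | true  | x≡b = ⊥-elim (a≢b (trans (sym (x≡a _)) (x≡b _)))
... | true  | _   | false | _   = refl
... | false | _   | _     | _   = refl

pair≡singleton-Δ-singleton : ∀ n {a b} → a ≢ b → pair n a b ≡ singleton n a Δ singleton n b
pair≡singleton-Δ-singleton n {a} {b} a≢b = sym (trans
  (zipWith-tabulate _xor_ (λ x → toℕ x ≡ᵇ a) (λ x → toℕ x ≡ᵇ b))
  (tabulate-cong λ x → sym (∨≡xor (toℕ x ≡ᵇ a) (toℕ x ≡ᵇ b) (≡ᵇ-∧-≡ᵇ a≢b (toℕ x)))))

pair-Δ-pair : ∀ n {a b c} → a ≢ b → b ≢ c → a ≢ c → pair n a b Δ pair n b c ≡ pair n a c
pair-Δ-pair n {a} {b} {c} a≢b b≢c a≢c = begin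
  pair n a b Δ pair n b c
    ≡⟨ cong₂ _Δ_ (pair≡singleton-Δ-singleton n a≢b) (pair≡singleton-Δ-singleton n b≢c) ⟩
  (singleton n a Δ singleton n b) Δ (singleton n b Δ singleton n c)
    ≡⟨ Δ-cancel-middle (singleton n a) (singleton n b) (singleton n c) ⟩
  singleton n a Δ singleton n c
    ≡⟨ sym (pair≡singleton-Δ-singleton n a≢c) ⟩
  pair n a c ∎
  where open ≡-Reasoning

parityOn : ∀ {n} → (ℕ → Bool) → Subset n → Bool
parityOn P [] = false
parityOn P (b ∷ A) = (P 0 ∧ b) xor parityOn (P ∘ suc) A

parityOn-⊥ : ∀ {n} P → parityOn P (⊥ {n}) ≡ false
parityOn-⊥ {zero} P = refl
parityOn-⊥ {suc n} P = trans (cong (_xor parityOn (P ∘ suc) (⊥ {n})) (∧-zeroʳ (P 0))) (parityOn-⊥ {n} (P ∘ suc))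

parityOn-Δ : ∀ {n} P (A B : Subset n) → parityOn P (A Δ B) ≡ parityOn P A xor parityOn P B
parityOn-Δ P [] [] = refl
parityOn-Δ P (a ∷ A) (b ∷ B) = begin
  (P 0 ∧ (a xor b)) xor parityOn (P ∘ suc) (A Δ B)
    ≡⟨ cong₂ _xor_ (∧-distribˡ-xor (P 0) a b) (parityOn-Δ (P ∘ suc) A B) ⟩
  ((P 0 ∧ a) xor (P 0 ∧ b)) xor (parityOn (P ∘ suc) A xor parityOn (P ∘ suc) B)
    ≡⟨ interchange (P 0 ∧ a) (P 0 ∧ b) _ _ ⟩
  ((P 0 ∧ a) xor parityOn (P ∘ suc) A) xor ((P 0 ∧ b) xor parityOn (P ∘ suc) B) ∎
  where open ≡-Reasoning

tabulate-false≡⊥ : ∀ {n} → tabulate (λ (_ : Fin n) → false) ≡ ⊥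
tabulate-false≡⊥ {zero} = refl
tabulate-false≡⊥ {suc n} = cong (false ∷_) tabulate-false≡⊥

parityOn-singleton : ∀ {n a} P → a < n → parityOn P (singleton n a) ≡ P a
parityOn-singleton {suc n} {zero} P _ = begin
  (P 0 ∧ true) xor parityOn (P ∘ suc) (tabulate (λ (_ : Fin n) → false))
    ≡⟨ cong₂ _xor_ (∧-identityʳ (P 0)) (cong (parityOn (P ∘ suc)) (tabulate-false≡⊥ {n})) ⟩
  P 0 xor parityOn (P ∘ suc) (⊥ {n})
    ≡⟨ cong (P 0 xor_) (parityOn-⊥ {n} (P ∘ suc)) ⟩
  P 0 xor false
    ≡⟨ xor-identityʳ (P 0) ⟩
  P 0 ∎
  where open ≡-Reasoning
parityOn-singleton {suc n} {suc a} P (s≤s a<n) =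
  trans (cong (_xor parityOn (P ∘ suc) (singleton n a)) (∧-zeroʳ (P 0))) (parityOn-singleton (P ∘ suc) a<n)

parityOn-pair : ∀ n {a b} P → a ≢ b → a < n → b < n → parityOn P (pair n a b) ≡ P a xor P b
parityOn-pair n {a} {b} P a≢b a<n b<n = begin
  parityOn P (pair n a b)
    ≡⟨ cong (parityOn P) (pair≡singleton-Δ-singleton n a≢b) ⟩
  parityOn P (singleton n a Δ singleton n b)
    ≡⟨ parityOn-Δ P (singleton n a) (singleton n b) ⟩
  parityOn P (singleton n a) xor parityOn P (singleton n b)
    ≡⟨ cong₂ _xor_ (parityOn-singleton P a<n) (parityOn-singleton P b<n) ⟩
  P a xor P b ∎
  where open ≡-Reasoning

parityOn≡true⇒member : ∀ {n} P (A : Subset n) → parityOn P A ≡ true → ∃ λ i → P (toℕ i) ≡ true × lookup A i ≡ true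
parityOn≡true⇒member P (b ∷ A) odd with P 0 in P0 | b
... | true  | true  = zero , P0 , refl
... | true  | false = Σ-map suc id (parityOn≡true⇒member (P ∘ suc) A odd)
... | false | _     = Σ-map suc id (parityOn≡true⇒member (P ∘ suc) A odd)

lookup-Δ-singleton : ∀ {n} (A : Subset n) a j → lookup (A Δ singleton n a) j ≡ lookup A j xor (toℕ j ≡ᵇ a)
lookup-Δ-singleton A a j = trans (lookup-zipWith _xor_ j A _) (cong (lookup A j xor_) (lookup∘tabulate _ j))

parityOn≡false⇒another-member : ∀ {n} P (A : Subset n) i → parityOn P A ≡ false →
  P (toℕ i) ≡ true → lookup A i ≡ true → ∃ λ j → j ≢ i × P (toℕ j) ≡ true × lookup A j ≡ true
parityOn≡false⇒another-member {n} P A i even Pi i∈A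
  with parityOn≡true⇒member P (A Δ singleton n (toℕ i))
         (trans (parityOn-Δ P A _) (cong₂ _xor_ even (trans (parityOn-singleton P (toℕ<n i)) Pi)))
... | j , Pj , j∈A′ with toℕ j ≟ toℕ i
...   | yes j≡i = contradiction (begin
          true                                ≡⟨ sym j∈A′ ⟩
          lookup (A Δ singleton n (toℕ i)) j  ≡⟨ lookup-Δ-singleton A (toℕ i) j ⟩
          lookup A j xor (toℕ j ≡ᵇ toℕ i)     ≡⟨ cong₂ _xor_ (trans (cong (lookup A) (toℕ-injective j≡i)) i∈A)
                                                              (dec-true (_ ≟ _) j≡i) ⟩
          false                               ∎) (λ ())
  where open ≡-Reasoning
...   | no j≢i = j , j≢i ∘ cong toℕ , Pj , (begin
          lookup A j                          ≡⟨ sym (xor-identityʳ (lookup A j)) ⟩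
          lookup A j xor false                ≡⟨ cong (lookup A j xor_) (sym (dec-false (_ ≟ _) j≢i)) ⟩
          lookup A j xor (toℕ j ≡ᵇ toℕ i)     ≡⟨ sym (lookup-Δ-singleton A (toℕ i) j) ⟩
          lookup (A Δ singleton n (toℕ i)) j  ≡⟨ j∈A′ ⟩
          true                                ∎)
  where open ≡-Reasoning

sum-replicate : ∀ n x → sum (replicate n x) ≡ n * x
sum-replicate zero x = refl
sum-replicate (suc n) x = cong (x +_) (sum-replicate n x)

≤∸1⇒< : ∀ {j n} → 1 ≤ n → j ≤ n ∸ 1 → j < n
≤∸1⇒< 1≤n j≤n∸1 = ≤-trans (s≤s j≤n∸1) (≤-reflexive (m+[n∸m]≡n 1≤n))

2*k+1<2*n : ∀ {k n} → k < n → 2 * k + 1 < 2 * n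
2*k+1<2*n {k} {n} k<n = subst (_≤ 2 * n) 2*[1+k]≡1+[2*k+1] (*-monoʳ-≤ 2 k<n)
  where
  2*[1+k]≡1+[2*k+1] : 2 * suc k ≡ suc (2 * k + 1)
  2*[1+k]≡1+[2*k+1] = trans (*-suc 2 k) (cong suc (+-comm 1 (2 * k)))

2^[1+n]≡2^n+2^n : ∀ n → 2 ^ suc n ≡ 2 ^ n + 2 ^ n
2^[1+n]≡2^n+2^n n = cong (2 ^ n +_) (+-identityʳ (2 ^ n))

2^n<2^[1+n] : ∀ n → 2 ^ n < 2 ^ suc n
2^n<2^[1+n] n = ^-monoʳ-< 2 (s≤s (s≤s z≤n)) (n<1+n n)

2^e+j<2^[1+e] : ∀ e {j} → j < 2 ^ e → 2 ^ e + j < 2 ^ suc e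
2^e+j<2^[1+e] e {j} j<2^e = subst (2 ^ e + j <_) (sym (2^[1+n]≡2^n+2^n e)) (+-monoʳ-< (2 ^ e) j<2^e)

2^[1+m]/2≡2^m : ∀ m → 2 ^ suc m / 2 ≡ 2 ^ m
2^[1+m]/2≡2^m m = trans (cong (_/ 2) (*-comm 2 (2 ^ m))) (m*n/n≡m (2 ^ m) 2)

odd-split : ∀ f {k} → 2 ^ f ≤ k → k < 2 ^ suc f →
  ∃ λ k′ → k′ < 2 ^ f × 2 * k + 1 ≡ 2 ^ suc f + (2 * k′ + 1)
odd-split f {k} 2^f≤k k<2^[1+f] = k ∸ 2 ^ f , k′<2^f , (begin
  2 * k + 1                       ≡⟨ cong (λ x → 2 * x + 1) (sym 2^f+k′≡k) ⟩
  2 * (2 ^ f + (k ∸ 2 ^ f)) + 1   ≡⟨ cong (_+ 1) (*-distribˡ-+ 2 (2 ^ f) (k ∸ 2 ^ f)) ⟩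
  2 * 2 ^ f + 2 * (k ∸ 2 ^ f) + 1 ≡⟨ +-assoc (2 * 2 ^ f) (2 * (k ∸ 2 ^ f)) 1 ⟩
  2 ^ suc f + (2 * (k ∸ 2 ^ f) + 1) ∎)
  where
  open ≡-Reasoning
  2^f+k′≡k : 2 ^ f + (k ∸ 2 ^ f) ≡ k
  2^f+k′≡k = m+[n∸m]≡n 2^f≤k
  k′<2^f : k ∸ 2 ^ f < 2 ^ f
  k′<2^f = +-cancelˡ-< (2 ^ f) (k ∸ 2 ^ f) (2 ^ f)
    (subst₂ _<_ (sym 2^f+k′≡k) (2^[1+n]≡2^n+2^n f) k<2^[1+f])

^-monoʳ-∣ : ∀ b {m n} → m ≤ n → b ^ m ∣ b ^ n
^-monoʳ-∣ b {n = n} z≤n = 1∣ (b ^ n)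
^-monoʳ-∣ b (s≤s m≤n) = *-monoʳ-∣ b (^-monoʳ-∣ b m≤n)

not-between-powers : ∀ {e x} k → 2 ^ e < x → x < 2 ^ suc e → x ≢ 2 ^ k
not-between-powers {e} k 2^e<x x<2^[1+e] refl with k ≤? e
... | yes k≤e = <⇒≱ 2^e<x (^-monoʳ-≤ 2 k≤e)
... | no k≰e = <⇒≱ x<2^[1+e] (^-monoʳ-≤ 2 (≰⇒> k≰e))

does≡true⇒ : ∀ {p} {P : Set p} (P? : Dec P) → does P? ≡ true → P
does≡true⇒ (yes p) _ = p

module _ (k : ℕ) where

  private instance
    2^[1+k]≢0 : NonZero (2 ^ suc k)
    2^[1+k]≢0 = m^n≢0 2 (suc k)

  hasValuation : ℕ → Bool
  hasValuation y = does (y % 2 ^ suc k ≟ 2 ^ k)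

  hasValuation-2^ : hasValuation (2 ^ k) ≡ true
  hasValuation-2^ = dec-true (_ ≟ _) (m<n⇒m%n≡m (2^n<2^[1+n] k))

  hasValuation-shift : ∀ e {j} → 1 ≤ j → j < 2 ^ e → hasValuation (2 ^ e + j) ≡ hasValuation j
  hasValuation-shift e {j} 1≤j j<2^e with suc k ≤? e
  ... | yes k<e = cong (λ r → does (r ≟ 2 ^ k)) (%-remove-+ˡ j (^-monoʳ-∣ 2 k<e))
  ... | no k≮e = trans (dec-false (_ ≟ _) shifted≢) (sym (dec-false (_ ≟ _) unshifted≢))
    where
    e≤k : e ≤ k
    e≤k = ≤-pred (≰⇒> k≮e)
    j<2^k : j < 2 ^ k
    j<2^k = <-≤-trans j<2^e (^-monoʳ-≤ 2 e≤k)
    shifted<2^[1+e] : 2 ^ e + j < 2 ^ suc e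
    shifted<2^[1+e] = 2^e+j<2^[1+e] e j<2^e
    shifted≢ : (2 ^ e + j) % 2 ^ suc k ≢ 2 ^ k
    shifted≢ rewrite m<n⇒m%n≡m (<-≤-trans shifted<2^[1+e] (^-monoʳ-≤ 2 (s≤s e≤k))) =
      not-between-powers {e} k (m<m+n (2 ^ e) 1≤j) shifted<2^[1+e]
    unshifted≢ : j % 2 ^ suc k ≢ 2 ^ k
    unshifted≢ rewrite m<n⇒m%n≡m (<-trans j<2^k (2^n<2^[1+n] k)) = <⇒≢ j<2^k

  hasValuation⇒≡ : ∀ y → hasValuation y ≡ true → ∃ λ c → y ≡ 2 ^ k + c * 2 ^ suc k
  hasValuation⇒≡ y val = y / 2 ^ suc k , (begin
    y                                         ≡⟨ m≡m%n+[m/n]*n y (2 ^ suc k) ⟩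
    y % 2 ^ suc k + y / 2 ^ suc k * 2 ^ suc k ≡⟨ cong (_+ y / 2 ^ suc k * 2 ^ suc k) (does≡true⇒ (_ ≟ _) val) ⟩
    2 ^ k + y / 2 ^ suc k * 2 ^ suc k         ∎)
    where open ≡-Reasoning

IsGen⇒pair : ∀ {m A} → IsGen m A →
  ∃ λ e → ∃ λ j → 1 ≤ j × j < 2 ^ e × e < m × A ≡ pair (2 ^ m) j (2 ^ e + j)
IsGen⇒pair (suc e , j , _ , e<m , 1≤j , j≤2^e∸1 , A≡pair) =
  e , j , 1≤j , ≤∸1⇒< (m^n>0 2 e) j≤2^e∸1 , e<m , A≡pair

pair-∈H : ∀ {m} e {j} → 1 ≤ e → e < m → 1 ≤ j → j < 2 ^ e → InH m (pair (2 ^ m) j (2 ^ e + j))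
pair-∈H e {j} 1≤e e<m 1≤j j<2^e = gen (suc e , j , s≤s 1≤e , e<m , 1≤j , ∸-monoˡ-≤ 1 j<2^e , refl)

pair-∈H-trans : ∀ {m a b c} → a ≢ b → b ≢ c → a ≢ c →
  InH m (pair (2 ^ m) a b) → InH m (pair (2 ^ m) b c) → InH m (pair (2 ^ m) a c)
pair-∈H-trans {m} a≢b b≢c a≢c ab∈H bc∈H = subst (InH m) (pair-Δ-pair (2 ^ m) a≢b b≢c a≢c) (ab∈H Δ-cl bc∈H)

InH⇒parityOn≡false : ∀ {m A} → InH m A → ∀ k → parityOn (hasValuation k) A ≡ false
InH⇒parityOn≡false {m} (gen g) k with IsGen⇒pair g
... | e , j , 1≤j , j<2^e , e<m , refl = begin
  parityOn (hasValuation k) (pair (2 ^ m) j (2 ^ e + j))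
    ≡⟨ parityOn-pair (2 ^ m) (hasValuation k) (<⇒≢ j<2^e+j) (<-trans j<2^e+j 2^e+j<2^m) 2^e+j<2^m ⟩
  hasValuation k j xor hasValuation k (2 ^ e + j)
    ≡⟨ cong (hasValuation k j xor_) (hasValuation-shift k e 1≤j j<2^e) ⟩
  hasValuation k j xor hasValuation k j
    ≡⟨ xor-same (hasValuation k j) ⟩
  false ∎
  where
  open ≡-Reasoning
  j<2^e+j : j < 2 ^ e + j
  j<2^e+j = m<n+m j (m^n>0 2 e)
  2^e+j<2^m : 2 ^ e + j < 2 ^ m
  2^e+j<2^m = <-≤-trans (2^e+j<2^[1+e] e j<2^e) (^-monoʳ-≤ 2 e<m)
InH⇒parityOn≡false {m} zero k = parityOn-⊥ {2 ^ m} (hasValuation k)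
InH⇒parityOn≡false (_Δ-cl_ {A} {B} A∈H B∈H) k = trans (parityOn-Δ (hasValuation k) A B)
  (cong₂ _xor_ (InH⇒parityOn≡false A∈H k) (InH⇒parityOn≡false B∈H k))

InH-∋2^k⇒∋2^k+[1+c]*2^[1+k] : ∀ {m A} → InH m A → ∀ k → A ∋ℕ (2 ^ k) →
  ∃ λ c → A ∋ℕ (2 ^ k + suc c * 2 ^ suc k)
InH-∋2^k⇒∋2^k+[1+c]*2^[1+k] {A = A} A∈H k (i , i≡2^k , i∈A)
  with parityOn≡false⇒another-member (hasValuation k) A i (InH⇒parityOn≡false A∈H k)
         (trans (cong (hasValuation k) i≡2^k) (hasValuation-2^ k)) ([]=⇒lookup i∈A)
... | j , j≢i , val , j∈A with hasValuation⇒≡ k (toℕ j) val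
...   | zero , j≡2^k = contradiction (toℕ-injective (trans (trans j≡2^k (+-identityʳ (2 ^ k))) (sym i≡2^k))) j≢i
...   | suc c , j≡ = c , j , j≡ , lookup⇒[]= j A j∈A

pair-1-odd-∈H : ∀ {m} e → e < m → ∀ {k} → 1 ≤ k → k < 2 ^ e → InH m (pair (2 ^ m) 1 (2 * k + 1))
pair-1-odd-∈H zero _ 1≤k k<1 = contradiction 1≤k (<⇒≱ k<1)
pair-1-odd-∈H {m} (suc f) 1+f<m {k} 1≤k k<2^[1+f] with k <? 2 ^ f
... | yes k<2^f = pair-1-odd-∈H f (<-trans (n<1+n f) 1+f<m) 1≤k k<2^f
... | no k≮2^f with odd-split f (≮⇒≥ k≮2^f) k<2^[1+f]
...   | zero , 1<2^f , 2k+1≡ = subst (InH m ∘ pair (2 ^ m) 1) (sym 2k+1≡)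
          (pair-∈H (suc f) (s≤s z≤n) 1+f<m ≤-refl (2*k+1<2*n 1<2^f))
...   | suc k″ , k′<2^f , 2k+1≡ = subst (InH m ∘ pair (2 ^ m) 1) (sym 2k+1≡)
          (pair-∈H-trans (<⇒≢ 1<j) (<⇒≢ j<2^[1+f]+j) (<⇒≢ (<-≤-trans 1<j (m≤n+m j (2 ^ suc f))))
            (pair-1-odd-∈H f (<-trans (n<1+n f) 1+f<m) (s≤s z≤n) k′<2^f)
            (pair-∈H (suc f) (s≤s z≤n) 1+f<m (m≤n+m 1 (2 * suc k″)) (2*k+1<2*n k′<2^f)))
  where
  j : ℕ
  j = 2 * suc k″ + 1
  1<j : 1 < j
  1<j = ≤-trans (*-monoʳ-≤ 2 (s≤s z≤n)) (m≤m+n (2 * suc k″) 1)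
  j<2^[1+f]+j : j < 2 ^ suc f + j
  j<2^[1+f]+j = m<n+m j (m^n>0 2 (suc f))

lemma2p5 : (m : ℕ) → 2 ≤ m →
    ((∀ A → InH m A → ¬ (A ∋ℕ (2 ^ m))) × (∀ A → InH m A → ¬ (A ∋ℕ (2 ^ (m ∸ 1)))))
    × (∀ A → InH m A → ∀ k → A ∋ℕ (2 ^ k) →
         ∃ λ (ks : List ℕ) → ks ≢ [] × All (k <_) ks ×
           A ∋ℕ (2 ^ k + sum (map (2 ^_) ks)))
    × (∀ k → 1 ≤ k → k ≤ 2 ^ m / 2 ∸ 1 → InH m (pair (2 ^ m) 1 (2 * k + 1)))
lemma2p5 m@(suc m-1) (s≤s _) = (2^m∉A , 2^[m-1]∉A) , ∋2^k⇒∋2^k+Σ2^kᵢ , pair-1-[2k+1]∈H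
  where
  2^m∉A : ∀ A → InH m A → ¬ (A ∋ℕ (2 ^ m))
  2^m∉A A _ (i , i≡2^m , _) = <⇒≢ (toℕ<n i) i≡2^m
  2^[m-1]∉A : ∀ A → InH m A → ¬ (A ∋ℕ (2 ^ (m ∸ 1)))
  2^[m-1]∉A A A∈H ∋2^[m-1] with InH-∋2^k⇒∋2^k+[1+c]*2^[1+k] A∈H m-1 ∋2^[m-1]
  ... | c , i , i≡ , _ = <⇒≱ (toℕ<n i)
        (subst (2 ^ m ≤_) (sym i≡) (≤-trans (m≤m+n (2 ^ m) (c * 2 ^ m)) (m≤n+m _ (2 ^ m-1))))
  ∋2^k⇒∋2^k+Σ2^kᵢ : ∀ A → InH m A → ∀ k → A ∋ℕ (2 ^ k) →
    ∃ λ (ks : List ℕ) → ks ≢ [] × All (k <_) ks × A ∋ℕ (2 ^ k + sum (map (2 ^_) ks))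
  -- the exponents k′ᵢ may repeat: take c + 1 copies of k + 1
  ∋2^k⇒∋2^k+Σ2^kᵢ A A∈H k ∋2^k with InH-∋2^k⇒∋2^k+[1+c]*2^[1+k] A∈H k ∋2^k
  ... | c , ∋2^k+[1+c]*2^[1+k] = replicate (suc c) (suc k) , (λ ()) , replicate⁺ (suc c) (n<1+n k) ,
        subst (λ x → A ∋ℕ (2 ^ k + x))
          (sym (trans (cong sum (map-replicate (2 ^_) (suc c) (suc k))) (sum-replicate (suc c) (2 ^ suc k))))
          ∋2^k+[1+c]*2^[1+k]
  pair-1-[2k+1]∈H : ∀ k → 1 ≤ k → k ≤ 2 ^ m / 2 ∸ 1 → InH m (pair (2 ^ m) 1 (2 * k + 1))
  pair-1-[2k+1]∈H k 1≤k k≤ = pair-1-odd-∈H m-1 ≤-refl 1≤k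
    (≤∸1⇒< (m^n>0 2 m-1) (subst (λ x → k ≤ x ∸ 1) (2^[1+m]/2≡2^m m-1) k≤))
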